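{- Let $S_1,\dots,S_n$ be finite subsets of $R$, $\Lambda$ a finite set, and $(\varepsilon(i,u,\lambda)\mid i\in[1,n],u\in S_i,\lambda\in\Lambda)$ natural numbers. Let $\theta(\lambda)=(\sum_{u\in S_1}\varepsilon(1,u,\lambda),\dots,\sum_{u\in S_n}\varepsilon(n,u,\lambda))$, $D=\{\theta(\lambda)\mid\lambda\in\Lambda\}$, and for $a\in\prod_iS_i$ let $B_a=\{(\varepsilon(1,a_1,\lambda),\dots,\varepsilon(n,a_n,\lambda))\mid\lambda\in\Lambda\}$. Assume $\mathbb{N}^n\setminus\nabla(D)$ is finite. Then $$\sum_{a\in\prod_{i=1}^nS_i}|\mathbb{N}^n\setminus\nabla(B_a)|\leqslant|\mathbb{N}^n\setminus\nabla(D)|.$$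
   Context: $R$ is a commutative ring with identity, $n$ a positive integer, $[1,n]=\{1,\dots,n\}$, $\mathbb{N}=\{0,1,2,\dots\}$. For $\alpha,\beta\in\mathbb{N}^n$, $\alpha\leqslant\beta$ means $\alpha_i\leqslant\beta_i$ for all $i$, and for $A\subseteq\mathbb{N}^n$, $\nabla(A)=\{\beta\in\mathbb{N}^n:\exists\alpha\in A,\ \alpha\leqslant\beta\}$. -}

module Defs where

open import Level using (Level)
open import Data.Nat using (ℕ; zero; suc; _≤_)
open import Data.Fin using (Fin; zero; suc)
open import Data.List using (List; []; _∷_; map; concatMap; length; allFin)
open import Data.Nat.ListAction using (sum)
open import Data.Vec using (Vec; tabulate)
open import Data.Vec.Relation.Binary.Pointwise.Inductive using (Pointwise)
open import Data.Product using (Σ; ∃; _×_; _,_)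
open import Data.List.Membership.Propositional using (_∈_)
open import Data.List.Relation.Unary.Unique.Propositional using (Unique)
open import Relation.Binary.PropositionalEquality using (_≡_)
open import Relation.Nullary using (¬_)
open import Function.Bundles using (_⇔_)

_≤ⁿ_ : {n : ℕ} → Vec ℕ n → Vec ℕ n → Set
_≤ⁿ_ = Pointwise _≤_

∇ : {n : ℕ} → (Vec ℕ n → Set) → Vec ℕ n → Set
∇ A β = ∃ λ α → A α × (α ≤ⁿ β)

Compl : {n : ℕ} → (Vec ℕ n → Set) → Vec ℕ n → Set
Compl X β = ¬ X β

HasCard : {n : ℕ} → (Vec ℕ n → Set) → ℕ → Set
HasCard {n} X k =
  Σ (List (Vec ℕ n)) λ L → Unique L × (∀ β → (β ∈ L) ⇔ X β) × (length L ≡ k)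

∑Fin : (k : ℕ) → (Fin k → ℕ) → ℕ
∑Fin k f = sum (map f (allFin k))

Choice : (n : ℕ) → (Fin n → ℕ) → Set
Choice n s = (i : Fin n) → Fin (s i)

consChoice : {n : ℕ} {s : Fin (suc n) → ℕ} →
             Fin (s zero) → Choice n (λ i → s (suc i)) → Choice (suc n) s
consChoice x a zero    = x
consChoice x a (suc i) = a i

allChoices : (n : ℕ) (s : Fin n → ℕ) → List (Choice n s)
allChoices zero    s = (λ ()) ∷ []
allChoices (suc n) s =
  concatMap (λ x → map (consChoice x) (allChoices n (λ i → s (suc i))))
            (allFin (s zero))

∑Choice : (n : ℕ) (s : Fin n → ℕ) → (Choice n s → ℕ) → ℕ
∑Choice n s f = sum (map f (allChoices n s))

{-# OPTIONS --safe #-}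
module Submission where

-- Count inside a box [0, M)ⁿ containing ℕⁿ ∖ ∇(D); every ℕⁿ ∖ ∇(B_a) fits in it too, since B_a
-- lies coordinatewise below θ. Induct on n by slicing off the first coordinate: the slice of
-- ℕⁿ ∖ ∇(A) at height t is ℕⁿ⁻¹ ∖ ∇(A_t), where A_t consists of the tails of the generators whose
-- first coordinate is at most t. For a fixed first choice a₁ = x, induction compares the slices of
-- the B_(x,a′) with those of the generators (ε(1,x,λ), θ₂(λ), …, θₙ(λ)). Summing over x is then
-- done column by column: above a tail γ, ℕⁿ ∖ ∇ is the interval [0, min h), h ranging over the
-- first coordinates of the generators with tail ≤ γ, and a sum of minima is at most the minimum
-- of the sums θ₁(λ) = Σₓ ε(1,x,λ).

open import Defs
open import Level using (Level)
open import Algebra.Bundles using (CommutativeRing)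
open import Data.Nat using (ℕ; zero; suc; _≤_; _<_; _+_; z≤n; s≤s)
open import Data.Nat.Properties
open import Algebra.Properties.CommutativeSemigroup +-commutativeSemigroup using (interchange)
open import Data.Nat.ListAction using (sum)
open import Data.Nat.ListAction.Properties using (sum-++)
open import Data.Fin using (Fin; zero; suc)
open import Data.Vec using (Vec; tabulate; []; _∷_)
import Data.Vec as Vec
open import Data.Vec.Properties using (∷-injective)
open import Data.Vec.Relation.Binary.Pointwise.Inductive as Pointwise using (_∷_; tabulate⁺)
open import Data.Vec.Relation.Unary.All as VecAll using ([]; _∷_) renaming (All to VecAll)
open import Data.Product using (Σ; ∃; _×_; _,_; proj₂)
open import Data.List
  using (List; []; _∷_; _++_; map; concatMap; length; filter; allFin; upTo; cartesianProductWith)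
open import Data.List.Properties using (map-cong; map-++; map-∘; length-upTo; length-++)
open import Data.List.Membership.Propositional using (_∈_; find)
open import Data.List.Membership.Propositional.Properties
  using (∈-allFin; ∈-∃++; ∈-++⁺ˡ; ∈-++⁺ʳ; ∈-++⁻; ∈-upTo⁺; ∈-upTo⁻; ∈-filter⁺; ∈-filter⁻;
         ∈-cartesianProductWith⁺)
open import Data.List.Relation.Unary.Any using (here; there)
open import Data.List.Relation.Unary.All as All using (All; []; all?)
open import Data.List.Relation.Unary.All.Properties.Core using (¬All⇒Any¬)
open import Data.List.Relation.Unary.AllPairs using ([]; _∷_)
open import Data.List.Relation.Unary.Unique.Propositional using (Unique)
import Data.List.Relation.Unary.Unique.Propositional.Properties as Unique
open import Data.List.Relation.Binary.Subset.Propositional using (_⊆_)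
open import Data.Sum using (inj₁; inj₂)
open import Data.Bool using (true; false; if_then_else_)
open import Relation.Binary.PropositionalEquality
open import Relation.Nullary using (¬_; Dec; does; ¬?; _→-dec_; contradiction)
open import Relation.Nullary.Decidable using (decidable-stable; does-⇔)
open import Relation.Unary using (Decidable)
open import Function using (_∘_)
open import Function.Bundles using (_⇔_; mk⇔; Equivalence)
open import Function.Construct.Symmetry using (⇔-sym)
open import Function.Construct.Composition using (_⇔-∘_)

open Equivalence using (to; from)

private variable
  A X Y L : Set
  n : ℕ

∑ : List A → (A → ℕ) → ℕ
∑ xs f = sum (map f xs)

syntax ∑ xs (λ x → e) = ∑[ x ← xs ] e

∑-cong : (xs : List A) {f g : A → ℕ} → (∀ x → f x ≡ g x) → ∑ xs f ≡ ∑ xs g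
∑-cong xs f≗g = cong sum (map-cong f≗g xs)

∑-mono-≤ : (xs : List A) {f g : A → ℕ} → (∀ x → f x ≤ g x) → ∑ xs f ≤ ∑ xs g
∑-mono-≤ []       f≤g = z≤n
∑-mono-≤ (x ∷ xs) f≤g = +-mono-≤ (f≤g x) (∑-mono-≤ xs f≤g)

∈⇒≤∑ : {xs : List A} (f : A → ℕ) {x : A} → x ∈ xs → f x ≤ ∑ xs f
∈⇒≤∑ f (here refl)  = m≤m+n _ _
∈⇒≤∑ f (there x∈xs) = ≤-trans (∈⇒≤∑ f x∈xs) (m≤n+m _ _)

∑-++ : (xs ys : List A) (f : A → ℕ) → ∑ (xs ++ ys) f ≡ ∑ xs f + ∑ ys f
∑-++ xs ys f = trans (cong sum (map-++ f xs ys)) (sum-++ (map f xs) (map f ys))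

∑-map : (g : X → A) (xs : List X) (f : A → ℕ) → ∑ (map g xs) f ≡ ∑ xs (f ∘ g)
∑-map g xs f = cong sum (sym (map-∘ xs))

∑-concatMap : (g : X → List A) (xs : List X) (f : A → ℕ) →
              ∑ (concatMap g xs) f ≡ ∑[ x ← xs ] ∑ (g x) f
∑-concatMap g []       f = refl
∑-concatMap g (x ∷ xs) f = trans (∑-++ (g x) _ f) (cong (∑ (g x) f +_) (∑-concatMap g xs f))

∑-cartesianProductWith : (_∙_ : X → Y → A) (xs : List X) (ys : List Y) (f : A → ℕ) →
                         ∑ (cartesianProductWith _∙_ xs ys) f ≡ ∑[ x ← xs ] ∑[ y ← ys ] f (x ∙ y)
∑-cartesianProductWith _∙_ []       ys f = refl
∑-cartesianProductWith _∙_ (x ∷ xs) ys f =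
  trans (∑-++ (map (x ∙_) ys) _ f) (cong₂ _+_ (∑-map (x ∙_) ys f) (∑-cartesianProductWith _∙_ xs ys f))

∑-0 : (xs : List A) → ∑[ x ← xs ] 0 ≡ 0
∑-0 []       = refl
∑-0 (x ∷ xs) = ∑-0 xs

∑-+ : (xs : List A) (f g : A → ℕ) → ∑[ x ← xs ] (f x + g x) ≡ ∑ xs f + ∑ xs g
∑-+ []       f g = refl
∑-+ (x ∷ xs) f g = trans (cong (f x + g x +_) (∑-+ xs f g)) (interchange (f x) (g x) _ _)

∑-comm : (xs : List A) (ys : List X) (f : A → X → ℕ) →
         ∑[ x ← xs ] ∑[ y ← ys ] f x y ≡ ∑[ y ← ys ] ∑[ x ← xs ] f x y
∑-comm []       ys f = sym (∑-0 ys)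
∑-comm (x ∷ xs) ys f = trans (cong (∑ ys (f x) +_) (∑-comm xs ys f)) (sym (∑-+ ys (f x) _))

Unique-⊆⇒length-≤ : {xs ys : List A} → Unique xs → xs ⊆ ys → length xs ≤ length ys
Unique-⊆⇒length-≤ {xs = []} _ _ = z≤n
Unique-⊆⇒length-≤ {xs = x ∷ xs} (x∉xs ∷ xs!) xs⊆ys with ∈-∃++ (xs⊆ys (here refl))
... | ys₁ , ys₂ , refl = begin
  suc (length xs)                ≤⟨ s≤s (Unique-⊆⇒length-≤ xs! xs⊆ys₁++ys₂) ⟩
  suc (length (ys₁ ++ ys₂))      ≡⟨ cong suc (length-++ ys₁) ⟩
  suc (length ys₁ + length ys₂)  ≡⟨ +-suc (length ys₁) _ ⟨
  length ys₁ + suc (length ys₂)  ≡⟨ length-++ ys₁ ⟨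
  length (ys₁ ++ x ∷ ys₂)        ∎
  where
  open ≤-Reasoning
  xs⊆ys₁++ys₂ : xs ⊆ ys₁ ++ ys₂
  xs⊆ys₁++ys₂ {y} y∈xs with ∈-++⁻ ys₁ (xs⊆ys (there y∈xs))
  ... | inj₁ y∈ys₁         = ∈-++⁺ˡ y∈ys₁
  ... | inj₂ (here refl)   = contradiction refl (All.lookup x∉xs y∈xs)
  ... | inj₂ (there y∈ys₂) = ∈-++⁺ʳ ys₁ y∈ys₂

HasCard-unique : {X : Vec ℕ n → Set} {k k′ : ℕ} → HasCard X k → HasCard X k′ → k ≡ k′
HasCard-unique (xs , xs! , xs↔X , refl) (ys , ys! , ys↔X , refl) =
  ≤-antisym (Unique-⊆⇒length-≤ xs! (λ {β} → from (ys↔X β) ∘ to (xs↔X β)))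
            (Unique-⊆⇒length-≤ ys! (λ {β} → from (xs↔X β) ∘ to (ys↔X β)))

count : {P : A → Set} → Decidable P → List A → ℕ
count P? xs = ∑[ x ← xs ] (if does (P? x) then 1 else 0)

count-cong : {P Q : A → Set} (P? : Decidable P) (Q? : Decidable Q) (xs : List A) →
             (∀ x → P x ⇔ Q x) → count P? xs ≡ count Q? xs
count-cong P? Q? xs P⇔Q =
  ∑-cong xs (λ x → cong (λ b → if b then 1 else 0) (does-⇔ (P⇔Q x) (P? x) (Q? x)))

count≡length-filter : {P : A → Set} (P? : Decidable P) (xs : List A) →
                      count P? xs ≡ length (filter P? xs)
count≡length-filter P? []       = refl
count≡length-filter P? (x ∷ xs) with does (P? x)
... | true  = cong suc (count≡length-filter P? xs)
... | false = count≡length-filter P? xs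

count-upTo-≤ : {P : ℕ → Set} (P? : Decidable P) (M : ℕ) {K : ℕ} →
               (∀ {t} → P t → t < K) → count P? (upTo M) ≤ K
count-upTo-≤ P? M {K} P⇒<K = begin
  count P? (upTo M)            ≡⟨ count≡length-filter P? (upTo M) ⟩
  length (filter P? (upTo M))  ≤⟨ Unique-⊆⇒length-≤ (Unique.filter⁺ P? {upTo M} (Unique.upTo⁺ M))
                                                     (∈-upTo⁺ ∘ P⇒<K ∘ proj₂ ∘ ∈-filter⁻ P? {xs = upTo M}) ⟩
  length (upTo K)              ≡⟨ length-upTo K ⟩
  K                            ∎
  where open ≤-Reasoning

≤-count-upTo : {P : ℕ → Set} (P? : Decidable P) {C M : ℕ} →
               C ≤ M → (∀ {t} → t < C → P t) → C ≤ count P? (upTo M)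
≤-count-upTo P? {C} {M} C≤M <C⇒P = begin
  C                            ≡⟨ length-upTo C ⟨
  length (upTo C)              ≤⟨ Unique-⊆⇒length-≤ (Unique.upTo⁺ C) upTo-C⊆ ⟩
  length (filter P? (upTo M))  ≡⟨ count≡length-filter P? (upTo M) ⟨
  count P? (upTo M)            ∎
  where
  open ≤-Reasoning
  upTo-C⊆ : upTo C ⊆ filter P? (upTo M)
  upTo-C⊆ t∈ = ∈-filter⁺ P? (∈-upTo⁺ (<-≤-trans (∈-upTo⁻ t∈) C≤M)) (<C⇒P (∈-upTo⁻ t∈))

box : ℕ → (n : ℕ) → List (Vec ℕ n)
box M zero    = [] ∷ []
box M (suc n) = cartesianProductWith _∷_ (upTo M) (box M n)

box-unique : (M n : ℕ) → Unique (box M n)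
box-unique M zero    = [] ∷ []
box-unique M (suc n) = Unique.cartesianProductWith⁺ _∷_ ∷-injective (Unique.upTo⁺ M) (box-unique M n)

∈-box⁺ : {M n : ℕ} {β : Vec ℕ n} → VecAll (_< M) β → β ∈ box M n
∈-box⁺ []          = here refl
∈-box⁺ (t<M ∷ γ<M) = ∈-cartesianProductWith⁺ _∷_ (∈-upTo⁺ t<M) (∈-box⁺ γ<M)

count-box-suc : {P : Vec ℕ (suc n) → Set} (P? : Decidable P) (M : ℕ) →
                count P? (box M (suc n)) ≡ ∑[ t ← upTo M ] count (λ γ → P? (t ∷ γ)) (box M n)
count-box-suc {n} P? M = ∑-cartesianProductWith _∷_ (upTo M) (box M n) _

_≤ⁿ?_ : (α β : Vec ℕ n) → Dec (α ≤ⁿ β)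
_≤ⁿ?_ = Pointwise.decidable _≤?_

≤ⁿ-trans : {α β γ : Vec ℕ n} → α ≤ⁿ β → β ≤ⁿ γ → α ≤ⁿ γ
≤ⁿ-trans = Pointwise.trans ≤-trans

Outside : List L → (L → Vec ℕ n) → Vec ℕ n → Set
Outside Λ g β = All (λ l → ¬ g l ≤ⁿ β) Λ

outside? : (Λ : List L) (g : L → Vec ℕ n) → Decidable (Outside Λ g)
outside? Λ g β = all? (λ l → ¬? (g l ≤ⁿ? β)) Λ

#Outside : ℕ → List L → (L → Vec ℕ n) → ℕ
#Outside {n = n} M Λ g = count (outside? Λ g) (box M n)

Bounded : ℕ → List L → (L → Vec ℕ n) → Set
Bounded M Λ g = ∀ {β} → Outside Λ g β → VecAll (_< M) β

Outside-mono : {Λ : List L} {g g′ : L → Vec ℕ n} → (∀ l → g l ≤ⁿ g′ l) →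
               ∀ {β} → Outside Λ g β → Outside Λ g′ β
Outside-mono g≤g′ = All.map (λ {l} g≰β g′≤β → g≰β (≤ⁿ-trans (g≤g′ l) g′≤β))

Bounded-mono : {M : ℕ} {Λ : List L} {g g′ : L → Vec ℕ n} → (∀ l → g l ≤ⁿ g′ l) →
               Bounded M Λ g′ → Bounded M Λ g
Bounded-mono g≤g′ bounded = bounded ∘ Outside-mono g≤g′

BelowOn : List L → (L → Set) → (L → ℕ) → ℕ → Set
BelowOn Λ G h t = All (λ l → G l → t < h l) Λ

belowOn? : (Λ : List L) {G : L → Set} → Decidable G → (h : L → ℕ) → Decidable (BelowOn Λ G h)
belowOn? Λ G? h t = all? (λ l → G? l →-dec t <? h l) Λ

module _ {Λ : List L} {h : L → ℕ} {g : L → Vec ℕ n} {t : ℕ} {γ : Vec ℕ n} where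

  Outside-∷⇔BelowOn : Outside Λ (λ l → h l ∷ g l) (t ∷ γ) ⇔ BelowOn Λ (λ l → g l ≤ⁿ γ) h t
  Outside-∷⇔BelowOn = mk⇔
    (All.map λ h∷g≰ g≤γ → ≰⇒> (λ h≤t → h∷g≰ (h≤t ∷ g≤γ)))
    (All.map λ below → λ { (h≤t ∷ g≤γ) → <⇒≱ (below g≤γ) h≤t })

  Outside-filter⇔BelowOn : Outside (filter (λ l → h l ≤? t) Λ) g γ ⇔ BelowOn Λ (λ l → g l ≤ⁿ γ) h t
  Outside-filter⇔BelowOn = mk⇔
    (λ out → All.tabulate λ l∈Λ g≤γ → ≰⇒> λ h≤t →
      All.lookup out (∈-filter⁺ (λ l → h l ≤? t) l∈Λ h≤t) g≤γ)
    (λ below → All.tabulate λ l∈ g≤γ →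
      let l∈Λ , h≤t = ∈-filter⁻ (λ l → h l ≤? t) {xs = Λ} l∈ in <⇒≱ (All.lookup below l∈Λ g≤γ) h≤t)

module _ (M : ℕ) (Λ : List L) (h : L → ℕ) (g : L → Vec ℕ n) where

  private
    outside-∷? : ∀ t γ → Dec (Outside Λ (λ l → h l ∷ g l) (t ∷ γ))
    outside-∷? t γ = outside? Λ (λ l → h l ∷ g l) (t ∷ γ)

  #Outside-rows : #Outside M Λ (λ l → h l ∷ g l) ≡
                  ∑[ t ← upTo M ] #Outside M (filter (λ l → h l ≤? t) Λ) g
  #Outside-rows = trans (count-box-suc (outside? Λ _) M) (∑-cong (upTo M) λ t →
    count-cong (outside-∷? t) (outside? (filter (λ l → h l ≤? t) Λ) g) (box M n) λ γ →
      ⇔-sym (Outside-filter⇔BelowOn {Λ = Λ} {h} {g}) ⇔-∘ Outside-∷⇔BelowOn)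

  #Outside-columns : #Outside M Λ (λ l → h l ∷ g l) ≡
                     ∑[ γ ← box M n ] count (belowOn? Λ (λ l → g l ≤ⁿ? γ) h) (upTo M)
  #Outside-columns = trans (count-box-suc (outside? Λ _) M) (trans (∑-comm (upTo M) (box M n) _)
    (∑-cong (box M n) λ γ →
      count-cong (λ t → outside-∷? t γ) (belowOn? Λ (λ l → g l ≤ⁿ? γ) h) (upTo M) λ t →
        Outside-∷⇔BelowOn {Λ = Λ} {h} {g}))

module _ {M : ℕ} {Λ : List L} {h : L → ℕ} {g : L → Vec ℕ n} (bounded : Bounded M Λ (λ l → h l ∷ g l)) where

  Bounded-filter : {h′ : L → ℕ} → (∀ l → h′ l ≤ h l) → ∀ t → Bounded M (filter (λ l → h′ l ≤? t) Λ) g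
  Bounded-filter h′≤h t out = VecAll.tail (bounded (from Outside-∷⇔BelowOn
    (All.map (λ {l} below g≤γ → <-≤-trans (below g≤γ) (h′≤h l)) (to Outside-filter⇔BelowOn out))))

  Bounded⇒generator-below : ∀ γ → ∃ λ l → l ∈ Λ × g l ≤ⁿ γ × h l ≤ M
  Bounded⇒generator-below γ
    -- M ∷ γ lies outside the box, hence in ∇.
    with l , l∈Λ , ¬¬h∷g≤ ← find (¬All⇒Any¬ (λ l → ¬? ((h l ∷ g l) ≤ⁿ? (M ∷ γ))) Λ
                                            (λ out → n≮n M (VecAll.head (bounded out))))
    with h≤M ∷ g≤γ ← decidable-stable ((h l ∷ g l) ≤ⁿ? (M ∷ γ)) ¬¬h∷g≤
    = l , l∈Λ , g≤γ , h≤M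

module _ {Λ : List L} {G : L → Set} (G? : Decidable G) (M : ℕ) where

  count-BelowOn-≤ : (h : L → ℕ) {l : L} → l ∈ Λ → G l → count (belowOn? Λ G? h) (upTo M) ≤ h l
  count-BelowOn-≤ h l∈Λ Gl = count-upTo-≤ (belowOn? Λ G? h) M (λ below → All.lookup below l∈Λ Gl)

  ∑-count-BelowOn-≤ : (xs : List A) (h : A → L → ℕ) {l : L} → l ∈ Λ → G l → ∑[ x ← xs ] h x l ≤ M →
                      ∑[ x ← xs ] count (belowOn? Λ G? (h x)) (upTo M) ≤
                      count (belowOn? Λ G? (λ l → ∑[ x ← xs ] h x l)) (upTo M)
  ∑-count-BelowOn-≤ xs h l∈Λ Gl ∑h≤M =
    ≤-count-upTo (belowOn? Λ G? _) (≤-trans (≤∑h l∈Λ Gl) ∑h≤M)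
      (λ t<C → All.tabulate λ l′∈Λ Gl′ → <-≤-trans t<C (≤∑h l′∈Λ Gl′))
    where
    ≤∑h : ∀ {l} → l ∈ Λ → G l → ∑[ x ← xs ] count (belowOn? Λ G? (h x)) (upTo M) ≤ ∑[ x ← xs ] h x l
    ≤∑h l∈Λ Gl = ∑-mono-≤ xs λ x → count-BelowOn-≤ (h x) l∈Λ Gl

θ : (s : Fin n → ℕ) → ((i : Fin n) → Fin (s i) → L → ℕ) → L → Vec ℕ n
θ s ε l = tabulate (λ i → ∑Fin (s i) (λ u → ε i u l))

B : {s : Fin n → ℕ} → ((i : Fin n) → Fin (s i) → L → ℕ) → Choice n s → L → Vec ℕ n
B ε a l = tabulate (λ i → ε i (a i) l)

B≤θ : {s : Fin n → ℕ} (ε : (i : Fin n) → Fin (s i) → L → ℕ) (a : Choice n s) (l : L) →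
      B ε a l ≤ⁿ θ s ε l
B≤θ ε a l = tabulate⁺ λ i → ∈⇒≤∑ (λ u → ε i u l) (∈-allFin (a i))

∑Choice-suc : (s : Fin (suc n) → ℕ) (f : Choice (suc n) s → ℕ) →
              ∑Choice (suc n) s f ≡ ∑[ x ← allFin (s zero) ] ∑Choice n (s ∘ suc) (f ∘ consChoice x)
∑Choice-suc {n} s f = trans (∑-concatMap _ (allFin (s zero)) f)
  (∑-cong (allFin (s zero)) λ x → ∑-map (consChoice x) (allChoices n (s ∘ suc)) f)

module _ {M : ℕ} {Λ : List L} (xs : List A) (h : A → L → ℕ) (g : L → Vec ℕ n) where

  #Outside-∷-superadditive : Bounded M Λ (λ l → ∑[ x ← xs ] h x l ∷ g l) →
                             ∑[ x ← xs ] #Outside M Λ (λ l → h x l ∷ g l) ≤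
                             #Outside M Λ (λ l → ∑[ x ← xs ] h x l ∷ g l)
  #Outside-∷-superadditive bounded = begin
    ∑[ x ← xs ] #Outside M Λ (λ l → h x l ∷ g l)
      ≡⟨ ∑-cong xs (λ x → #Outside-columns M Λ (h x) g) ⟩
    ∑[ x ← xs ] ∑[ γ ← box M n ] count (belowOn? Λ (g≤? γ) (h x)) (upTo M)
      ≡⟨ ∑-comm xs (box M n) _ ⟩
    ∑[ γ ← box M n ] ∑[ x ← xs ] count (belowOn? Λ (g≤? γ) (h x)) (upTo M)
      ≤⟨ ∑-mono-≤ (box M n) column-bound ⟩
    ∑[ γ ← box M n ] count (belowOn? Λ (g≤? γ) (λ l → ∑[ x ← xs ] h x l)) (upTo M)
      ≡⟨ #Outside-columns M Λ (λ l → ∑[ x ← xs ] h x l) g ⟨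
    #Outside M Λ (λ l → ∑[ x ← xs ] h x l ∷ g l) ∎
    where
    open ≤-Reasoning
    g≤? : (γ : Vec ℕ n) → Decidable (λ l → g l ≤ⁿ γ)
    g≤? γ l = g l ≤ⁿ? γ
    column-bound : ∀ γ → ∑[ x ← xs ] count (belowOn? Λ (g≤? γ) (h x)) (upTo M) ≤
                         count (belowOn? Λ (g≤? γ) (λ l → ∑[ x ← xs ] h x l)) (upTo M)
    column-bound γ with l , l∈Λ , g≤γ , ∑h≤M ← Bounded⇒generator-below bounded γ =
      ∑-count-BelowOn-≤ (g≤? γ) M xs h l∈Λ g≤γ ∑h≤M

∑#Outside-B≤#Outside-θ : (M : ℕ) (s : Fin n → ℕ) (ε : (i : Fin n) → Fin (s i) → L → ℕ) (Λ : List L) →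
                         Bounded M Λ (θ s ε) →
                         ∑Choice n s (λ a → #Outside M Λ (B ε a)) ≤ #Outside M Λ (θ s ε)
∑#Outside-B≤#Outside-θ {n = zero}  M s ε Λ _ = ≤-reflexive (+-identityʳ _)
∑#Outside-B≤#Outside-θ {n = suc n} {L = L} M s ε Λ bounded = begin
  ∑Choice (suc n) s (λ a → #Outside M Λ (B ε a))
    ≡⟨ ∑Choice-suc s _ ⟩
  ∑[ x ← xs ] ∑[ a ← as ] #Outside M Λ (λ l → h x l ∷ B ε′ a l)
    ≡⟨ ∑-cong xs (λ x → ∑-cong as λ a → #Outside-rows M Λ (h x) (B ε′ a)) ⟩
  ∑[ x ← xs ] ∑[ a ← as ] ∑[ t ← upTo M ] #Outside M (Λ↾ x t) (B ε′ a)
    ≡⟨ ∑-cong xs (λ x → ∑-comm as (upTo M) _) ⟩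
  ∑[ x ← xs ] ∑[ t ← upTo M ] ∑[ a ← as ] #Outside M (Λ↾ x t) (B ε′ a)
    ≤⟨ ∑-mono-≤ xs (λ x → ∑-mono-≤ (upTo M) λ t →
         ∑#Outside-B≤#Outside-θ M s′ ε′ (Λ↾ x t) (Bounded-filter bounded (h≤θ₀ x) t)) ⟩
  ∑[ x ← xs ] ∑[ t ← upTo M ] #Outside M (Λ↾ x t) θ′
    ≡⟨ ∑-cong xs (λ x → #Outside-rows M Λ (h x) θ′) ⟨
  ∑[ x ← xs ] #Outside M Λ (λ l → h x l ∷ θ′ l)
    ≤⟨ #Outside-∷-superadditive xs h θ′ bounded ⟩
  #Outside M Λ (θ s ε) ∎
  where
  open ≤-Reasoning
  s′ : Fin n → ℕ
  s′ = s ∘ suc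
  ε′ : (i : Fin n) → Fin (s′ i) → L → ℕ
  ε′ = ε ∘ suc
  xs : List (Fin (s zero))
  xs = allFin (s zero)
  as : List (Choice n s′)
  as = allChoices n s′
  h : Fin (s zero) → L → ℕ
  h = ε zero
  θ′ : L → Vec ℕ n
  θ′ = θ s′ ε′
  Λ↾ : Fin (s zero) → ℕ → List L
  Λ↾ x t = filter (λ l → h x l ≤? t) Λ
  h≤θ₀ : ∀ x l → h x l ≤ ∑[ y ← xs ] h y l
  h≤θ₀ x l = ∈⇒≤∑ (λ y → h y l) (∈-allFin x)

Outside⇔Compl∇ : {m : ℕ} (g : Fin m → Vec ℕ n) (β : Vec ℕ n) →
                 Outside (allFin m) g β ⇔ Compl (∇ (λ α → ∃ λ l → g l ≡ α)) β
Outside⇔Compl∇ g β = mk⇔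
  (λ { out (_ , (l , refl) , g≤β) → All.lookup out (∈-allFin l) g≤β })
  (λ ∉∇ → All.tabulate λ {l} _ g≤β → ∉∇ (g l , (l , refl) , g≤β))

HasCard-#Outside : {M m : ℕ} {g : Fin m → Vec ℕ n} → Bounded M (allFin m) g →
                   HasCard (Compl (∇ (λ α → ∃ λ l → g l ≡ α))) (#Outside M (allFin m) g)
HasCard-#Outside {n} {M} {m} {g} bounded =
  filter P? (box M n) ,
  Unique.filter⁺ P? (box-unique M n) ,
  (λ β → Outside⇔Compl∇ g β ⇔-∘
         mk⇔ (proj₂ ∘ ∈-filter⁻ P? {xs = box M n}) (λ out → ∈-filter⁺ P? (∈-box⁺ (bounded out)) out)) ,
  sym (count≡length-filter P? (box M n))
  where
  P? : Decidable (Outside (allFin m) g)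
  P? = outside? (allFin m) g

All-≤-sum : (β : Vec ℕ n) → VecAll (_≤ Vec.sum β) β
All-≤-sum []      = []
All-≤-sum (x ∷ β) = m≤m+n x _ ∷ VecAll.map (λ y≤ → ≤-trans y≤ (m≤n+m _ x)) (All-≤-sum β)

∈⇒All<suc-∑sum : (βs : List (Vec ℕ n)) {β : Vec ℕ n} → β ∈ βs → VecAll (_< suc (∑ βs Vec.sum)) β
∈⇒All<suc-∑sum βs {β} β∈βs = VecAll.map (λ x≤ → s≤s (≤-trans x≤ (∈⇒≤∑ Vec.sum β∈βs))) (All-≤-sum β)

lemma5p1 : ∀ {c ℓ : Level} (R : CommutativeRing c ℓ) (n : ℕ) → 1 ≤ n →
    -- S i ⊆ R finite: the image of an injection Fin (s i) → R
    (s : Fin n → ℕ) (S : (i : Fin n) → Fin (s i) → CommutativeRing.Carrier R) →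
    (∀ i (u v : Fin (s i)) → CommutativeRing._≈_ R (S i u) (S i v) → u ≡ v) →
    -- Λ = Fin m, and ε(i, u, λ)
    (m : ℕ) (ε : (i : Fin n) → Fin (s i) → Fin m → ℕ) →
    let θ : Fin m → Vec ℕ n
        θ λ′ = tabulate (λ i → ∑Fin (s i) (λ u → ε i u λ′))
        D : Vec ℕ n → Set
        D α = ∃ λ λ′ → θ λ′ ≡ α
        B : Choice n s → Vec ℕ n → Set
        B a α = ∃ λ λ′ → tabulate (λ i → ε i (a i) λ′) ≡ α
    in (d : ℕ) → HasCard (Compl (∇ D)) d →
       Σ (Choice n s → ℕ) λ b →
         (∀ a → HasCard (Compl (∇ (B a))) (b a)) × (∑Choice n s b ≤ d)
-- Only the sizes s i of the sets S i enter.
lemma5p1 R n _ s S _ m ε d enumeration@(βs , _ , βs↔ , _) =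
  (λ a → #Outside M Λ (B ε a)) ,
  (λ a → HasCard-#Outside (Bounded-mono (B≤θ ε a) bounded)) ,
  subst (∑Choice n s (λ a → #Outside M Λ (B ε a)) ≤_)
        (HasCard-unique (HasCard-#Outside bounded) enumeration)
        (∑#Outside-B≤#Outside-θ M s ε Λ bounded)
  where
  Λ : List (Fin m)
  Λ = allFin m
  M : ℕ
  M = suc (∑ βs Vec.sum)
  bounded : Bounded M Λ (θ s ε)
  bounded {β} out = ∈⇒All<suc-∑sum βs (from (βs↔ β) (to (Outside⇔Compl∇ (θ s ε) β) out))
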